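{- Let $f\in\mathbf C[x,y]$ be a binary form of degree $d$ with two different honest representations $$f(x,y)=\sum_{i=1}^s\lambda_i(\alpha_ix+\beta_iy)^d=\sum_{j=1}^t\mu_j(\gamma_jx+\delta_jy)^d,$$ with all $\lambda_i,\mu_j$ nonzero. Then $s+t\ge d+2$. Moreover, if $s+t=d+2$, then the combined collection of linear forms $\{\alpha_ix+\beta_iy\}_{i}\cup\{\gamma_jx+\delta_jy\}_{j}$ is pairwise non-proportional.
   Context: A representation $f=\sum_i\lambda_i\ell_i^d$ (with $\lambda_i\in\mathbf C$ and $\ell_i$ nonzero linear forms) is honest if the linear forms $\ell_i$ are pairwise non-proportional. Two honest representations are different if the collection of summands $\lambda_i\ell_i^d$ (as polynomials) of one is not a rearrangement of that of the other. -}

module Defs where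

open import Level using (Level; _⊔_) renaming (suc to lsuc)
open import Data.Nat using (ℕ; zero; suc; _∸_)
import Data.Nat
import Data.Fin as Fin
open import Data.Nat.Combinatorics using (_C_)
open import Data.Fin using (Fin; toℕ)
open import Data.Product using (_×_; _,_; Σ; ∃; proj₁; proj₂)
open import Relation.Nullary using (¬_)
open import Relation.Binary.PropositionalEquality using (_≡_)
open import Algebra.Bundles using (CommutativeRing)
open import Function.Bundles using (_↔_; Inverse)
import Data.Vec.Functional as VF

module RingOps {c ℓ : Level} (R : CommutativeRing c ℓ) where
  open CommutativeRing R

  _•_ : ℕ → Carrier → Carrier
  zero  • x = 0#
  suc n • x = x + (n • x)

  _^_ : Carrier → ℕ → Carrier
  x ^ zero  = 1#
  x ^ suc n = x * (x ^ n)

  evalMonic : (n : ℕ) → (Fin (suc n) → Carrier) → Carrier → Carrier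
  evalMonic n a x = (x ^ suc n) + sumLow n a x
    where
    sumLow : (m : ℕ) → (Fin (suc m) → Carrier) → Carrier → Carrier
    sumLow zero    b x = b Fin.zero
    sumLow (suc m) b x = b Fin.zero + (x * sumLow m (λ k → b (Fin.suc k)) x)

-- A field of characteristic 0 that is algebraically closed: the
-- properties of ℂ used by the statement (ℂ itself is not available).
record ACField₀ (c ℓ : Level) : Set (lsuc (c ⊔ ℓ)) where
  field
    cring : CommutativeRing c ℓ
  open CommutativeRing cring public
  open RingOps cring public

  field
    1≉0        : ¬ (1# ≈ 0#)
    inverse    : ∀ x → ¬ (x ≈ 0#) → ∃ λ y → x * y ≈ 1#
    char0      : ∀ n → ¬ ((suc n • 1#) ≈ 0#)
    algClosed  : ∀ n (a : Fin (suc n) → Carrier) → ∃ λ x → evalMonic n a x ≈ 0#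

module Forms {c ℓ : Level} (K : ACField₀ c ℓ) where
  open ACField₀ K hiding (Carrier; _≈_; 0#)
  open ACField₀ K public using (Carrier; _≈_; 0#)

  -- a linear form  α x + β y  is the pair (α , β)
  LinForm : Set c
  LinForm = Carrier × Carrier

  NonZeroForm : LinForm → Set ℓ
  NonZeroForm (α , β) = ¬ ((α ≈ 0#) × (β ≈ 0#))

  Proportional : LinForm → LinForm → Set (c ⊔ ℓ)
  Proportional (α₁ , β₁) (α₂ , β₂) = ∃ λ k → (α₁ ≈ k * α₂) × (β₁ ≈ k * β₂)

  -- binary forms of degree d, as coefficient vectors:
  -- coefficient k is the coefficient of x^k y^(d-k)
  Form : ℕ → Set c
  Form d = Fin (suc d) → Carrier

  _≈F_ : ∀ {d} → Form d → Form d → Set ℓ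
  f ≈F g = ∀ k → f k ≈ g k

  _+F_ : ∀ {d} → Form d → Form d → Form d
  (f +F g) k = f k + g k

  0F : ∀ {d} → Form d
  0F k = 0#

  -- λ (α x + β y)^d, expanded by the binomial theorem
  powerTerm : (d : ℕ) → Carrier → LinForm → Form d
  powerTerm d lam (α , β) k =
    lam * ((d C toℕ k) • ((α ^ toℕ k) * (β ^ (d ∸ toℕ k))))

  sumTerms : (d s : ℕ) → (Fin s → Carrier) → (Fin s → LinForm) → Form d
  sumTerms d zero    lam l = 0F
  sumTerms d (suc s) lam l =
    powerTerm d (lam Fin.zero) (l Fin.zero)
      +F sumTerms d s (λ i → lam (Fin.suc i)) (λ i → l (Fin.suc i))

  PairwiseNonProp : (s : ℕ) → (Fin s → LinForm) → Set (c ⊔ ℓ)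
  PairwiseNonProp s l = ∀ i j → ¬ (i ≡ j) → ¬ Proportional (l i) (l j)

  Honest : (s : ℕ) → (Fin s → LinForm) → Set (c ⊔ ℓ)
  Honest s l = (∀ i → NonZeroForm (l i)) × PairwiseNonProp s l

  -- the multiset of summands of one representation is a rearrangement
  -- of that of the other
  Rearrangement : (d s t : ℕ) → (Fin s → Carrier) → (Fin s → LinForm)
                 → (Fin t → Carrier) → (Fin t → LinForm) → Set ℓ
  Rearrangement d s t lam l mu m =
    Σ (Fin s ↔ Fin t) λ σ →
      ∀ i → powerTerm d (lam i) (l i) ≈F powerTerm d (mu (Inverse.to σ i)) (m (Inverse.to σ i))

  combine : ∀ {s t} → (Fin s → LinForm) → (Fin t → LinForm) → Fin (s Data.Nat.+ t) → LinForm
  combine l m = l VF.++ m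

{-# OPTIONS --safe #-}
module Submission where

-- Subtracting one representation from the other gives a vanishing combination
-- of d-th powers.  The apolar operator b ∂ₓ − a ∂ᵧ lowers the degree by one,
-- kills (a x + b y)^d and multiplies every power of a form not proportional to
-- a x + b y by a nonzero scalar; so, by induction on d, at most d + 1 pairwise
-- non-proportional d-th powers are linearly independent.  Merging the summands
-- of one side into proportional summands of the other one at a time, a
-- difference involving at most d + 1 distinct lines (s + t ≤ d + 1, or
-- s + t = d + 2 with a proportional pair) must cancel summand by summand, i.e.
-- the two representations are rearrangements of each other.  Equality in the
-- field is not decidable, so the case analyses run in the double-negation
-- monad; this is harmless because every conclusion is a negation.

open import Defs
open import Level using (Level; _⊔_)
open import Data.Nat as ℕ using (ℕ; zero; suc; _∸_; NonZero; s≤s)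
import Data.Nat.Properties as ℕₚ
open import Data.Integer as ℤ using (ℤ; +_; -[1+_]; _⊖_)
import Data.Integer.Properties as ℤₚ
open import Data.Sign as Sign using (Sign)
open import Data.Fin as Fin using (Fin; toℕ; fromℕ; inject₁; splitAt; join)
import Data.Fin.Properties as Finₚ
open import Data.Vec.Functional using (_∷_; []; head; tail; updateAt)
open import Data.Vec.Functional.Properties using (updateAt-updates; updateAt-minimal)
open import Data.Maybe using (Maybe; just; nothing)
open import Data.Product using (∃; ∃₂; _×_; _,_; proj₁; proj₂)
open import Data.Sum using (_⊎_; inj₁; inj₂; [_,_]′)
open import Data.Empty using (⊥-elim)
open import Function using (_∘_; id)
open import Function.Bundles using (mk↔ₛ′)
open import Relation.Nullary using (¬_; Dec; yes; no)
open import Relation.Nullary.Negation using (contradiction; ¬¬-map; negated-stable)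
open import Relation.Nullary.Decidable using (¬¬-excluded-middle; decidable-stable)
open import Relation.Binary.PropositionalEquality as ≡ using (_≡_; _≢_)
open import Algebra.Bundles using (CommutativeRing)
import Algebra.Solver.Ring.AlmostCommutativeRing as ACR
import Algebra.Solver.Ring as RingSolver
import Relation.Binary.Reasoning.Setoid as SetoidReasoning

module Binomial where
  open import Data.Nat
  open import Data.Nat.Properties
  open import Data.Nat.DivMod using (m/n*n≡m)
  open import Data.Nat.Combinatorics using (_C_; k![n∸k]!∣n!; nCk≡nC[n∸k])
  open import Data.Nat.Combinatorics.Specification using (nCk≡n!/k![n-k]!)
  open import Data.Nat.Tactic.RingSolver using (solve-∀)
  open import Relation.Binary.PropositionalEquality
  open ≡-Reasoning

  nCk*k![n∸k]!≡n! : ∀ {n k} → k ≤ n → (n C k) * (k ! * (n ∸ k) !) ≡ n !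
  nCk*k![n∸k]!≡n! {n} {k} k≤n = trans (cong (_* (k ! * (n ∸ k) !)) (nCk≡n!/k![n-k]! k≤n))
    (m/n*n≡m {{k !* (n ∸ k) !≢0}} (k![n∸k]!∣n! k≤n))

  [k+1]*[n+1]C[k+1]≡[n+1]*nCk : ∀ {n k} → k ≤ n → suc k * (suc n C suc k) ≡ suc n * (n C k)
  [k+1]*[n+1]C[k+1]≡[n+1]*nCk {n} {k} k≤n = *-cancelʳ-≡ _ _ (k ! * (n ∸ k) !) {{k !* (n ∸ k) !≢0}} (begin
    suc k * (suc n C suc k) * (k ! * (n ∸ k) !)        ≡⟨ regroup (suc k) (suc n C suc k) (k !) ((n ∸ k) !) ⟩
    (suc n C suc k) * (suc k ! * (suc n ∸ suc k) !)    ≡⟨ nCk*k![n∸k]!≡n! (s≤s k≤n) ⟩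
    suc n !                                            ≡⟨ cong (suc n *_) (nCk*k![n∸k]!≡n! k≤n) ⟨
    suc n * ((n C k) * (k ! * (n ∸ k) !))              ≡⟨ *-assoc (suc n) (n C k) (k ! * (n ∸ k) !) ⟨
    suc n * (n C k) * (k ! * (n ∸ k) !)                ∎)
    where
    regroup : ∀ a b c e → a * b * (c * e) ≡ b * ((a * c) * e)
    regroup = solve-∀

  [n+1∸k]*[n+1]Ck≡[n+1]*nCk : ∀ {n k} → k ≤ n → suc (n ∸ k) * (suc n C k) ≡ suc n * (n C k)
  [n+1∸k]*[n+1]Ck≡[n+1]*nCk {n} {k} k≤n = begin
    suc (n ∸ k) * (suc n C k)                ≡⟨ cong (suc (n ∸ k) *_) (nCk≡nC[n∸k] (m≤n⇒m≤1+n k≤n)) ⟩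
    suc (n ∸ k) * (suc n C (suc n ∸ k))      ≡⟨ cong (λ j → suc (n ∸ k) * (suc n C j)) (+-∸-assoc 1 k≤n) ⟩
    suc (n ∸ k) * (suc n C suc (n ∸ k))      ≡⟨ [k+1]*[n+1]C[k+1]≡[n+1]*nCk (m∸n≤m n k) ⟩
    suc n * (n C (n ∸ k))                    ≡⟨ cong (suc n *_) (nCk≡nC[n∸k] k≤n) ⟨
    suc n * (n C k)                          ∎

open Binomial

-- The ring solver of the library needs a coefficient ring with a decidable
-- equality; ℤ acts on every commutative ring through ι n = n ×ᴿ 1#.
module IntegerCoefficients {c ℓ : Level} (R : CommutativeRing c ℓ) where
  open CommutativeRing R
  open import Algebra.Properties.Ring ring using (-‿distribˡ-*; -‿distribʳ-*; -‿involutive; -‿+-comm; -0#≈0#)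
  open import Algebra.Properties.Semiring.Mult semiring using (×-homo-+; ×1-homo-*) renaming (_×_ to _×ᴿ_)
  open SetoidReasoning setoid

  ι : ℕ → Carrier
  ι n = n ×ᴿ 1#

  ι-+ : ∀ m n → ι (m ℕ.+ n) ≈ ι m + ι n
  ι-+ = ×-homo-+ 1#

  ι-* : ∀ m n → ι (m ℕ.* n) ≈ ι m * ι n
  ι-* = ×1-homo-*

  ⟦_⟧ : ℤ → Carrier
  ⟦ + n ⟧      = ι n
  ⟦ -[1+ n ] ⟧ = - ι (suc n)

  x-y≈[1+x]-[1+y] : ∀ x y → x - y ≈ (1# + x) - (1# + y)
  x-y≈[1+x]-[1+y] x y = begin
    x - y                     ≈⟨ +-identityˡ _ ⟨
    0# + (x - y)              ≈⟨ +-congʳ (-‿inverseʳ 1#) ⟨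
    (1# - 1#) + (x - y)       ≈⟨ +-assoc _ _ _ ⟩
    1# + (- 1# + (x - y))     ≈⟨ +-congˡ (+-assoc _ _ _) ⟨
    1# + ((- 1# + x) - y)     ≈⟨ +-congˡ (+-congʳ (+-comm _ _)) ⟩
    1# + ((x - 1#) - y)       ≈⟨ +-congˡ (+-assoc _ _ _) ⟩
    1# + (x + (- 1# - y))     ≈⟨ +-congˡ (+-congˡ (-‿+-comm 1# y)) ⟩
    1# + (x - (1# + y))       ≈⟨ +-assoc _ _ _ ⟨
    (1# + x) - (1# + y)       ∎

  ⟦⊖⟧ : ∀ m n → ⟦ m ⊖ n ⟧ ≈ ι m - ι n
  ⟦⊖⟧ m       zero    = sym (trans (+-congˡ -0#≈0#) (+-identityʳ _))
  ⟦⊖⟧ zero    (suc n) = sym (+-identityˡ _)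
  ⟦⊖⟧ (suc m) (suc n) = begin
    ⟦ suc m ⊖ suc n ⟧         ≡⟨ ≡.cong ⟦_⟧ (ℤₚ.[1+m]⊖[1+n]≡m⊖n m n) ⟩
    ⟦ m ⊖ n ⟧                 ≈⟨ ⟦⊖⟧ m n ⟩
    ι m - ι n           ≈⟨ x-y≈[1+x]-[1+y] _ _ ⟩
    ι (suc m) - ι (suc n)   ∎

  ⟦+⟧ : ∀ i j → ⟦ i ℤ.+ j ⟧ ≈ ⟦ i ⟧ + ⟦ j ⟧
  ⟦+⟧ (+ m)      (+ n)      = ι-+ m n
  ⟦+⟧ (+ m)      -[1+ n ]   = ⟦⊖⟧ m (suc n)
  ⟦+⟧ -[1+ m ]   (+ n)      = trans (⟦⊖⟧ n (suc m)) (+-comm _ _)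
  ⟦+⟧ -[1+ m ]   -[1+ n ]   = begin
    - ι (suc (suc (m ℕ.+ n)))      ≡⟨ ≡.cong (λ k → - ι (suc k)) (ℕₚ.+-suc m n) ⟨
    - ι (suc m ℕ.+ suc n)        ≈⟨ -‿cong (ι-+ (suc m) (suc n)) ⟩
    - (ι (suc m) + ι (suc n))       ≈⟨ -‿+-comm _ _ ⟨
    ⟦ -[1+ m ] ⟧ + ⟦ -[1+ n ] ⟧       ∎

  ⟦_⟧ˢ : Sign → Carrier
  ⟦ Sign.+ ⟧ˢ = 1#
  ⟦ Sign.- ⟧ˢ = - 1#

  ⟦*⟧ˢ : ∀ s t → ⟦ s Sign.* t ⟧ˢ ≈ ⟦ s ⟧ˢ * ⟦ t ⟧ˢ
  ⟦*⟧ˢ Sign.+ t      = sym (*-identityˡ _)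
  ⟦*⟧ˢ Sign.- Sign.+ = sym (*-identityʳ _)
  ⟦*⟧ˢ Sign.- Sign.- = begin
    1#                ≈⟨ -‿involutive 1# ⟨
    - - 1#            ≈⟨ -‿cong (*-identityʳ _) ⟨
    - (- 1# * 1#)     ≈⟨ -‿distribʳ-* _ _ ⟩
    - 1# * - 1#       ∎

  ⟦◃⟧ : ∀ s n → ⟦ s ℤ.◃ n ⟧ ≈ ⟦ s ⟧ˢ * ι n
  ⟦◃⟧ s      zero    = sym (zeroʳ _)
  ⟦◃⟧ Sign.+ (suc n) = sym (*-identityˡ _)
  ⟦◃⟧ Sign.- (suc n) = trans (-‿cong (sym (*-identityˡ _))) (-‿distribˡ-* _ _)

  ⟦⟧≈sign*∣∣ : ∀ i → ⟦ i ⟧ ≈ ⟦ ℤ.sign i ⟧ˢ * ι ℤ.∣ i ∣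
  ⟦⟧≈sign*∣∣ (+ n)    = sym (*-identityˡ _)
  ⟦⟧≈sign*∣∣ -[1+ n ] = trans (-‿cong (sym (*-identityˡ _))) (-‿distribˡ-* _ _)

  ⟦*⟧ : ∀ i j → ⟦ i ℤ.* j ⟧ ≈ ⟦ i ⟧ * ⟦ j ⟧
  ⟦*⟧ i j = begin
    ⟦ i ℤ.* j ⟧                                       ≈⟨ ⟦◃⟧ (ℤ.sign i Sign.* ℤ.sign j) (ℤ.∣ i ∣ ℕ.* ℤ.∣ j ∣) ⟩
    ⟦ ℤ.sign i Sign.* ℤ.sign j ⟧ˢ * ι (ℤ.∣ i ∣ ℕ.* ℤ.∣ j ∣)
                                                      ≈⟨ *-cong (⟦*⟧ˢ (ℤ.sign i) (ℤ.sign j)) (ι-* ℤ.∣ i ∣ ℤ.∣ j ∣) ⟩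
    (σ * τ) * (ι ℤ.∣ i ∣ * ι ℤ.∣ j ∣)           ≈⟨ interchange σ τ _ _ ⟩
    (σ * ι ℤ.∣ i ∣) * (τ * ι ℤ.∣ j ∣)           ≈⟨ *-cong (⟦⟧≈sign*∣∣ i) (⟦⟧≈sign*∣∣ j) ⟨
    ⟦ i ⟧ * ⟦ j ⟧                                     ∎
    where
    σ = ⟦ ℤ.sign i ⟧ˢ
    τ = ⟦ ℤ.sign j ⟧ˢ
    interchange : ∀ a b x y → (a * b) * (x * y) ≈ (a * x) * (b * y)
    interchange a b x y = begin
      (a * b) * (x * y)     ≈⟨ *-assoc _ _ _ ⟩
      a * (b * (x * y))     ≈⟨ *-congˡ (*-assoc _ _ _) ⟨
      a * ((b * x) * y)     ≈⟨ *-congˡ (*-congʳ (*-comm _ _)) ⟩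
      a * ((x * b) * y)     ≈⟨ *-congˡ (*-assoc _ _ _) ⟩
      a * (x * (b * y))     ≈⟨ *-assoc _ _ _ ⟨
      (a * x) * (b * y)     ∎

  ⟦-⟧ : ∀ i → ⟦ ℤ.- i ⟧ ≈ - ⟦ i ⟧
  ⟦-⟧ (+ zero)  = sym -0#≈0#
  ⟦-⟧ (+ suc n) = refl
  ⟦-⟧ -[1+ n ]  = sym (-‿involutive _)

  homomorphism : ℤ.+-*-rawRing ACR.-Raw-AlmostCommutative⟶ ACR.fromCommutativeRing R
  homomorphism = record
    { ⟦_⟧ = ⟦_⟧ ; +-homo = ⟦+⟧ ; *-homo = ⟦*⟧ ; -‿homo = ⟦-⟧ ; 0-homo = refl ; 1-homo = +-identityʳ 1# }

  ⟦⟧-equal? : ∀ i j → Maybe (⟦ i ⟧ ≈ ⟦ j ⟧)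
  ⟦⟧-equal? i j with i ℤ.≟ j
  ... | yes ≡.refl = just refl
  ... | no _       = nothing

  open RingSolver ℤ.+-*-rawRing (ACR.fromCommutativeRing R) homomorphism ⟦⟧-equal? public
    using (solve; _:=_; _:+_; _:*_; _:-_; :-_; con)

module DoubleNegation where
  private
    variable
      a b : Level
      A : Set a
      B : Set b

  _>>=_ : ¬ ¬ A → (A → ¬ ¬ B) → ¬ ¬ B
  m >>= f = negated-stable (¬¬-map f m)

  pure : A → ¬ ¬ A
  pure = contradiction

  ¬¬-pull-Fin : ∀ {p} n {P : Fin n → Set p} → (∀ i → ¬ ¬ P i) → ¬ ¬ (∀ i → P i)
  ¬¬-pull-Fin zero    ¬¬P = pure λ ()
  ¬¬-pull-Fin (suc n) ¬¬P = do
    P₀ ← ¬¬P Fin.zero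
    Pₛ ← ¬¬-pull-Fin n (¬¬P ∘ Fin.suc)
    pure λ { Fin.zero → P₀ ; (Fin.suc i) → Pₛ i }

open DoubleNegation

module Representations {c ℓ : Level} (K : ACField₀ c ℓ) where
  open ACField₀ K
  open Forms K using (LinForm; NonZeroForm; Proportional; Form; _≈F_; _+F_; 0F; powerTerm; sumTerms;
                      PairwiseNonProp; Honest; Rearrangement; combine)
  open import Algebra.Properties.Ring ring using (-‿distribˡ-*; -‿involutive; -0#≈0#)
  open import Data.Nat.Combinatorics using (_C_; nCn≡1)
  open IntegerCoefficients cring
  open SetoidReasoning setoid

  x*y≈0⇒y≈0 : ∀ {x y} → x ≉ 0# → x * y ≈ 0# → y ≈ 0#
  x*y≈0⇒y≈0 {x} {y} x≉0 xy≈0 with inverse x x≉0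
  ... | x⁻¹ , xx⁻¹≈1 = begin
    y                 ≈⟨ *-identityˡ y ⟨
    1# * y            ≈⟨ *-congʳ xx⁻¹≈1 ⟨
    (x * x⁻¹) * y     ≈⟨ solve 3 (λ x x⁻¹ y → (x :* x⁻¹) :* y := x⁻¹ :* (x :* y)) refl x x⁻¹ y ⟩
    x⁻¹ * (x * y)     ≈⟨ *-congˡ xy≈0 ⟩
    x⁻¹ * 0#          ≈⟨ zeroʳ x⁻¹ ⟩
    0#                ∎

  *-≉0 : ∀ {x y} → x ≉ 0# → y ≉ 0# → x * y ≉ 0#
  *-≉0 x≉0 y≉0 = y≉0 ∘ x*y≈0⇒y≈0 x≉0

  ^-≉0 : ∀ {x} n → x ≉ 0# → x ^ n ≉ 0#
  ^-≉0 zero    x≉0 = 1≉0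
  ^-≉0 (suc n) x≉0 = *-≉0 x≉0 (^-≉0 n x≉0)

  -‿≉0 : ∀ {x} → x ≉ 0# → - x ≉ 0#
  -‿≉0 {x} x≉0 -x≈0 = x≉0 (trans (sym (-‿involutive x)) (trans (-‿cong -x≈0) -0#≈0#))

  x-y≈0⇒x≈y : ∀ {x y} → x - y ≈ 0# → x ≈ y
  x-y≈0⇒x≈y {x} {y} x-y≈0 = begin
    x              ≈⟨ solve 2 (λ x y → x := (x :- y) :+ y) refl x y ⟩
    (x - y) + y    ≈⟨ +-congʳ x-y≈0 ⟩
    0# + y         ≈⟨ +-identityˡ y ⟩
    y              ∎

  •≈ι* : ∀ n x → n • x ≈ ι n * x
  •≈ι* zero    x = sym (zeroˡ x)
  •≈ι* (suc n) x = begin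
    x + n • x           ≈⟨ +-cong (sym (*-identityˡ x)) (•≈ι* n x) ⟩
    1# * x + ι n * x    ≈⟨ distribʳ x 1# (ι n) ⟨
    ι (suc n) * x       ∎

  ι-suc≉0 : ∀ n → ι (suc n) ≉ 0#
  ι-suc≉0 n h = char0 n (trans (•≈ι* (suc n) 1#) (trans (*-identityʳ _) h))

  ^-cong : ∀ {x y} n → x ≈ y → x ^ n ≈ y ^ n
  ^-cong zero    x≈y = refl
  ^-cong (suc n) x≈y = *-cong x≈y (^-cong n x≈y)

  ^-distrib-* : ∀ x y n → (x * y) ^ n ≈ x ^ n * y ^ n
  ^-distrib-* x y zero    = sym (*-identityˡ 1#)
  ^-distrib-* x y (suc n) = trans (*-congˡ (^-distrib-* x y n))
    (solve 4 (λ x y a b → (x :* y) :* (a :* b) := (x :* a) :* (y :* b)) refl x y (x ^ n) (y ^ n))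

  ^-homo-* : ∀ x m n → x ^ (m ℕ.+ n) ≈ x ^ m * x ^ n
  ^-homo-* x zero    n = sym (*-identityˡ _)
  ^-homo-* x (suc m) n = trans (*-congˡ (^-homo-* x m n)) (sym (*-assoc _ _ _))

  det : LinForm → LinForm → Carrier
  det (a , b) (α , β) = b * α - a * β

  Proportional-sym : ∀ {ℓ₁ ℓ₂} → NonZeroForm ℓ₁ → Proportional ℓ₁ ℓ₂ → Proportional ℓ₂ ℓ₁
  Proportional-sym {α₁ , β₁} {α₂ , β₂} nz (k , α₁≈kα₂ , β₁≈kβ₂) with inverse k k≉0
    where
    k≉0 : k ≉ 0#
    k≉0 k≈0 = nz ( trans α₁≈kα₂ (trans (*-congʳ k≈0) (zeroˡ _))
                 , trans β₁≈kβ₂ (trans (*-congʳ k≈0) (zeroˡ _)))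
  ... | k⁻¹ , kk⁻¹≈1 = k⁻¹ , divide α₁≈kα₂ , divide β₁≈kβ₂
    where
    divide : ∀ {x y} → x ≈ k * y → y ≈ k⁻¹ * x
    divide {x} {y} x≈ky = begin
      y                ≈⟨ *-identityˡ y ⟨
      1# * y           ≈⟨ *-congʳ kk⁻¹≈1 ⟨
      (k * k⁻¹) * y    ≈⟨ solve 3 (λ k k⁻¹ y → (k :* k⁻¹) :* y := k⁻¹ :* (k :* y)) refl k k⁻¹ y ⟩
      k⁻¹ * (k * y)    ≈⟨ *-congˡ x≈ky ⟨
      k⁻¹ * x          ∎

  Proportional-trans : ∀ {ℓ₁ ℓ₂ ℓ₃} → Proportional ℓ₁ ℓ₂ → Proportional ℓ₂ ℓ₃ → Proportional ℓ₁ ℓ₃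
  Proportional-trans (k₁ , α₁₂ , β₁₂) (k₂ , α₂₃ , β₂₃) =
    k₁ * k₂ , trans α₁₂ (trans (*-congˡ α₂₃) (sym (*-assoc _ _ _)))
            , trans β₁₂ (trans (*-congˡ β₂₃) (sym (*-assoc _ _ _)))

  det≈0⇒¬¬Proportional : ∀ {ℓ₁ ℓ₂} → NonZeroForm ℓ₁ → det ℓ₁ ℓ₂ ≈ 0# → ¬ ¬ Proportional ℓ₂ ℓ₁
  det≈0⇒¬¬Proportional {a , b} {α , β} nz det≈0 = do
    a≈0? ← ¬¬-excluded-middle
    pure (cases a≈0?)
    where
    bα≈aβ : b * α ≈ a * β
    bα≈aβ = x-y≈0⇒x≈y det≈0
    cases : Dec (a ≈ 0#) → Proportional (α , β) (a , b)
    cases (no a≉0) with inverse a a≉0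
    ... | a⁻¹ , aa⁻¹≈1 = α * a⁻¹ , α≈αa⁻¹a , β≈αa⁻¹b
      where
      α≈αa⁻¹a : α ≈ (α * a⁻¹) * a
      α≈αa⁻¹a = begin
        α                 ≈⟨ *-identityʳ α ⟨
        α * 1#            ≈⟨ *-congˡ aa⁻¹≈1 ⟨
        α * (a * a⁻¹)     ≈⟨ solve 3 (λ α a a⁻¹ → α :* (a :* a⁻¹) := (α :* a⁻¹) :* a) refl α a a⁻¹ ⟩
        (α * a⁻¹) * a     ∎
      β≈αa⁻¹b : β ≈ (α * a⁻¹) * b
      β≈αa⁻¹b = begin
        β                 ≈⟨ *-identityˡ β ⟨
        1# * β            ≈⟨ *-congʳ aa⁻¹≈1 ⟨
        (a * a⁻¹) * β     ≈⟨ solve 3 (λ β a a⁻¹ → (a :* a⁻¹) :* β := a⁻¹ :* (a :* β)) refl β a a⁻¹ ⟩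
        a⁻¹ * (a * β)     ≈⟨ *-congˡ bα≈aβ ⟨
        a⁻¹ * (b * α)     ≈⟨ solve 3 (λ α b a⁻¹ → a⁻¹ :* (b :* α) := (α :* a⁻¹) :* b) refl α b a⁻¹ ⟩
        (α * a⁻¹) * b     ∎
    cases (yes a≈0) with inverse b b≉0
      where
      b≉0 : b ≉ 0#
      b≉0 b≈0 = nz (a≈0 , b≈0)
    ... | b⁻¹ , bb⁻¹≈1 = β * b⁻¹ , α≈βb⁻¹a , β≈βb⁻¹b
      where
      α≈βb⁻¹a : α ≈ (β * b⁻¹) * a
      α≈βb⁻¹a = trans (x*y≈0⇒y≈0 (λ b≈0 → nz (a≈0 , b≈0)) (trans bα≈aβ (trans (*-congʳ a≈0) (zeroˡ β))))
                      (sym (trans (*-congˡ a≈0) (zeroʳ _)))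
      β≈βb⁻¹b : β ≈ (β * b⁻¹) * b
      β≈βb⁻¹b = begin
        β                 ≈⟨ *-identityʳ β ⟨
        β * 1#            ≈⟨ *-congˡ bb⁻¹≈1 ⟨
        β * (b * b⁻¹)     ≈⟨ solve 3 (λ β b b⁻¹ → β :* (b :* b⁻¹) := (β :* b⁻¹) :* b) refl β b b⁻¹ ⟩
        (β * b⁻¹) * b     ∎

  ¬Proportional⇒det≉0 : ∀ {ℓ₁ ℓ₂} → NonZeroForm ℓ₁ → ¬ Proportional ℓ₂ ℓ₁ → det ℓ₁ ℓ₂ ≉ 0#
  ¬Proportional⇒det≉0 nz ¬p det≈0 = det≈0⇒¬¬Proportional nz det≈0 ¬p

  Honest-tail : ∀ {n} {L : Fin (suc n) → LinForm} → Honest (suc n) L → Honest n (tail L)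
  Honest-tail (nz , pw) = nz ∘ Fin.suc , λ i j i≢j → pw (Fin.suc i) (Fin.suc j) (i≢j ∘ Finₚ.suc-injective)

  Honest-∷ : ∀ {n ℓ₀} {L : Fin n → LinForm} → NonZeroForm ℓ₀ → (∀ j → ¬ Proportional ℓ₀ (L j)) →
             Honest n L → Honest (suc n) (ℓ₀ ∷ L)
  Honest-∷ {n} {ℓ₀} {L} nz₀ new (nz , pw) = nz′ , pw′
    where
    nz′ : ∀ i → NonZeroForm ((ℓ₀ ∷ L) i)
    nz′ Fin.zero    = nz₀
    nz′ (Fin.suc i) = nz i
    pw′ : PairwiseNonProp (suc n) (ℓ₀ ∷ L)
    pw′ Fin.zero    Fin.zero    0≢0 = contradiction ≡.refl 0≢0
    pw′ Fin.zero    (Fin.suc j) _   = new j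
    pw′ (Fin.suc i) Fin.zero    _   = new i ∘ Proportional-sym (nz i)
    pw′ (Fin.suc i) (Fin.suc j) i≢j = pw i j (i≢j ∘ ≡.cong Fin.suc)

  PairwiseNonProp-++ : ∀ {s t} {l : Fin s → LinForm} {m : Fin t → LinForm} →
    PairwiseNonProp s l → PairwiseNonProp t m → (∀ j → NonZeroForm (m j)) →
    (∀ i j → ¬ Proportional (l i) (m j)) → PairwiseNonProp (s ℕ.+ t) (combine l m)
  PairwiseNonProp-++ {s} {t} {l} {m} pl pm nzm new i j i≢j =
    apart (splitAt s i) (splitAt s j) (i≢j ∘ splitAt-injective)
    where
    splitAt-injective : splitAt s i ≡ splitAt s j → i ≡ j
    splitAt-injective eq = ≡.trans (≡.sym (Finₚ.join-splitAt s t i))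
                             (≡.trans (≡.cong (join s t) eq) (Finₚ.join-splitAt s t j))
    apart : ∀ x y → x ≢ y → ¬ Proportional ([ l , m ]′ x) ([ l , m ]′ y)
    apart (inj₁ a) (inj₁ b) a≢b = pl a b (a≢b ∘ ≡.cong inj₁)
    apart (inj₂ a) (inj₂ b) a≢b = pm a b (a≢b ∘ ≡.cong inj₂)
    apart (inj₁ a) (inj₂ b) _   = new a b
    apart (inj₂ a) (inj₁ b) _   = new b a ∘ Proportional-sym (nzm a)

  powerTerm-coefficient : ∀ d c α β (k : Fin (suc d)) {j} → toℕ k ≡ j →
    powerTerm d c (α , β) k ≈ c * (ι (d C j) * (α ^ j * β ^ (d ∸ j)))
  powerTerm-coefficient d c α β k ≡.refl = *-congˡ (•≈ι* (d C toℕ k) _)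

  powerTerm-+ : ∀ d x y ℓ′ → powerTerm d (x + y) ℓ′ ≈F (powerTerm d x ℓ′ +F powerTerm d y ℓ′)
  powerTerm-+ d x y ℓ′ k = distribʳ _ x y

  powerTerm-zero : ∀ d {x} ℓ′ → x ≈ 0# → powerTerm d x ℓ′ ≈F 0F
  powerTerm-zero d ℓ′ x≈0 k = trans (*-congʳ x≈0) (zeroˡ _)

  sumTerms-zero : ∀ d n (c : Fin n → Carrier) L → (∀ i → c i ≈ 0#) → sumTerms d n c L ≈F 0F
  sumTerms-zero d zero    c L c≈0 k = refl
  sumTerms-zero d (suc n) c L c≈0 k =
    trans (+-cong (powerTerm-zero d (head L) (c≈0 Fin.zero) k) (sumTerms-zero d n (tail c) (tail L) (c≈0 ∘ Fin.suc) k))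
          (+-identityʳ 0#)

  powerTerm-first : ∀ d c α β → powerTerm d c (α , β) Fin.zero ≈ c * β ^ d
  powerTerm-first d c α β = *-congˡ (trans (+-identityʳ _) (*-identityˡ _))

  powerTerm-last : ∀ d c α β → powerTerm d c (α , β) (fromℕ d) ≈ c * α ^ d
  powerTerm-last d c α β = begin
    powerTerm d c (α , β) (fromℕ d)          ≈⟨ powerTerm-coefficient d c α β (fromℕ d) (Finₚ.toℕ-fromℕ d) ⟩
    c * (ι (d C d) * (α ^ d * β ^ (d ∸ d)))  ≡⟨ ≡.cong₂ (λ n e → c * (ι n * (α ^ d * β ^ e))) (nCn≡1 d) (ℕₚ.n∸n≡0 d) ⟩
    c * ((1# + 0#) * (α ^ d * 1#))           ≈⟨ *-congˡ (trans (*-congʳ (+-identityʳ 1#)) (trans (*-identityˡ _) (*-identityʳ _))) ⟩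
    c * α ^ d                                ∎

  powerTerm≉0F : ∀ d {c ℓ′} → c ≉ 0# → NonZeroForm ℓ′ → ¬ (powerTerm d c ℓ′ ≈F 0F)
  powerTerm≉0F d {c} {α , β} c≉0 nz pt≈0 = ¬β≉0 λ β≈0 → ¬α≉0 λ α≈0 → nz (α≈0 , β≈0)
    where
    ¬α≉0 : ¬ (α ≉ 0#)
    ¬α≉0 α≉0 = *-≉0 c≉0 (^-≉0 d α≉0) (trans (sym (powerTerm-last d c α β)) (pt≈0 (fromℕ d)))
    ¬β≉0 : ¬ (β ≉ 0#)
    ¬β≉0 β≉0 = *-≉0 c≉0 (^-≉0 d β≉0) (trans (sym (powerTerm-first d c α β)) (pt≈0 Fin.zero))

  powerTerm-scale : ∀ d c {α₁ β₁ α₂ β₂ k} → α₁ ≈ k * α₂ → β₁ ≈ k * β₂ →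
                    powerTerm d c (α₁ , β₁) ≈F powerTerm d (c * k ^ d) (α₂ , β₂)
  powerTerm-scale d c {α₁} {β₁} {α₂} {β₂} {k} α₁≈kα₂ β₁≈kβ₂ j = begin
    powerTerm d c (α₁ , β₁) j
      ≈⟨ powerTerm-coefficient d c α₁ β₁ j ≡.refl ⟩
    c * (N * (α₁ ^ t * β₁ ^ u))
      ≈⟨ *-congˡ (*-congˡ (*-cong (trans (^-cong t α₁≈kα₂) (^-distrib-* k α₂ t))
                                  (trans (^-cong u β₁≈kβ₂) (^-distrib-* k β₂ u)))) ⟩
    c * (N * ((k ^ t * α₂ ^ t) * (k ^ u * β₂ ^ u)))
      ≈⟨ solve 6 (λ c N kt a ku b → c :* (N :* ((kt :* a) :* (ku :* b))) := (c :* (kt :* ku)) :* (N :* (a :* b)))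
           refl c N (k ^ t) (α₂ ^ t) (k ^ u) (β₂ ^ u) ⟩
    (c * (k ^ t * k ^ u)) * (N * (α₂ ^ t * β₂ ^ u))
      ≈⟨ *-congʳ (*-congˡ (trans (sym (^-homo-* k t u)) (reflexive (≡.cong (k ^_) (ℕₚ.m+[n∸m]≡n (Finₚ.toℕ≤pred[n] j)))))) ⟩
    (c * k ^ d) * (N * (α₂ ^ t * β₂ ^ u))
      ≈⟨ powerTerm-coefficient d (c * k ^ d) α₂ β₂ j ≡.refl ⟨
    powerTerm d (c * k ^ d) (α₂ , β₂) j ∎
    where
    t = toℕ j
    u = d ∸ t
    N = ι (d C t)

  -- ∂[ a , b ] is the operator b ∂ₓ − a ∂ᵧ (coefficient k belongs to x^k y^(d-k));
  -- it annihilates (a x + b y)^(d+1).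
  ∂[_] : ∀ {d} → LinForm → Form (suc d) → Form d
  ∂[_] {d} (a , b) f j = b * (ι (suc (toℕ j)) * f (Fin.suc j)) - a * (ι (suc d ∸ toℕ j) * f (inject₁ j))

  ι-cong-* : ∀ m n p q → m ℕ.* n ≡ p ℕ.* q → ι m * ι n ≈ ι p * ι q
  ι-cong-* m n p q mn≡pq = trans (sym (ι-* m n)) (trans (reflexive (≡.cong ι mn≡pq)) (ι-* p q))

  reshape : ∀ i c n x → i * (c * (n * x)) ≈ c * ((i * n) * x)
  reshape i c n x = solve 4 (λ i c n x → i :* (c :* (n :* x)) := c :* ((i :* n) :* x)) refl i c n x

  ∂ₓ-powerTerm : ∀ d c α β (j : Fin (suc d)) →
    ι (suc (toℕ j)) * powerTerm (suc d) c (α , β) (Fin.suc j) ≈ α * powerTerm d (c * ι (suc d)) (α , β) j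
  ∂ₓ-powerTerm d c α β j = begin
    ι (suc k) * powerTerm (suc d) c (α , β) (Fin.suc j)
      ≈⟨ *-congˡ (powerTerm-coefficient (suc d) c α β (Fin.suc j) ≡.refl) ⟩
    ι (suc k) * (c * (ι (suc d C suc k) * ((α * P) * Q)))
      ≈⟨ reshape _ _ _ _ ⟩
    c * ((ι (suc k) * ι (suc d C suc k)) * ((α * P) * Q))
      ≈⟨ *-congˡ (*-congʳ (ι-cong-* (suc k) (suc d C suc k) (suc d) (d C k) ([k+1]*[n+1]C[k+1]≡[n+1]*nCk (Finₚ.toℕ≤pred[n] j)))) ⟩
    c * ((ι (suc d) * ι (d C k)) * ((α * P) * Q))
      ≈⟨ solve 6 (λ c I N α P Q → c :* ((I :* N) :* ((α :* P) :* Q)) := α :* ((c :* I) :* (N :* (P :* Q))))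
           refl c (ι (suc d)) (ι (d C k)) α P Q ⟩
    α * ((c * ι (suc d)) * (ι (d C k) * (P * Q)))
      ≈⟨ *-congˡ (powerTerm-coefficient d (c * ι (suc d)) α β j ≡.refl) ⟨
    α * powerTerm d (c * ι (suc d)) (α , β) j ∎
    where
    k = toℕ j
    P = α ^ k
    Q = β ^ (d ∸ k)

  ∂ᵧ-powerTerm : ∀ d c α β (j : Fin (suc d)) →
    ι (suc d ∸ toℕ j) * powerTerm (suc d) c (α , β) (inject₁ j) ≈ β * powerTerm d (c * ι (suc d)) (α , β) j
  ∂ᵧ-powerTerm d c α β j = begin
    ι (suc d ∸ k) * powerTerm (suc d) c (α , β) (inject₁ j)
      ≈⟨ *-cong (reflexive (≡.cong ι d+1∸k≡1+[d∸k])) (powerTerm-coefficient (suc d) c α β (inject₁ j) (Finₚ.toℕ-inject₁ j)) ⟩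
    ι (suc (d ∸ k)) * (c * (ι (suc d C k) * (P * β ^ (suc d ∸ k))))
      ≡⟨ ≡.cong (λ e → ι (suc (d ∸ k)) * (c * (ι (suc d C k) * (P * β ^ e)))) d+1∸k≡1+[d∸k] ⟩
    ι (suc (d ∸ k)) * (c * (ι (suc d C k) * (P * (β * Q))))
      ≈⟨ reshape _ _ _ _ ⟩
    c * ((ι (suc (d ∸ k)) * ι (suc d C k)) * (P * (β * Q)))
      ≈⟨ *-congˡ (*-congʳ (ι-cong-* (suc (d ∸ k)) (suc d C k) (suc d) (d C k) ([n+1∸k]*[n+1]Ck≡[n+1]*nCk k≤d))) ⟩
    c * ((ι (suc d) * ι (d C k)) * (P * (β * Q)))
      ≈⟨ solve 6 (λ c I N β P Q → c :* ((I :* N) :* (P :* (β :* Q))) := β :* ((c :* I) :* (N :* (P :* Q))))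
           refl c (ι (suc d)) (ι (d C k)) β P Q ⟩
    β * ((c * ι (suc d)) * (ι (d C k) * (P * Q)))
      ≈⟨ *-congˡ (powerTerm-coefficient d (c * ι (suc d)) α β j ≡.refl) ⟨
    β * powerTerm d (c * ι (suc d)) (α , β) j ∎
    where
    k = toℕ j
    k≤d = Finₚ.toℕ≤pred[n] j
    d+1∸k≡1+[d∸k] = ℕₚ.+-∸-assoc 1 k≤d
    P = α ^ k
    Q = β ^ (d ∸ k)

  ∂-powerTerm : ∀ d c ℓ₀ ℓ′ → ∂[ ℓ₀ ] (powerTerm (suc d) c ℓ′) ≈F powerTerm d (det ℓ₀ ℓ′ * (c * ι (suc d))) ℓ′
  ∂-powerTerm d c (a , b) (α , β) j = begin
    ∂[ a , b ] (powerTerm (suc d) c (α , β)) j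
      ≈⟨ +-cong (*-congˡ (∂ₓ-powerTerm d c α β j)) (-‿cong (*-congˡ (∂ᵧ-powerTerm d c α β j))) ⟩
    b * (α * T) - a * (β * T)
      ≈⟨ solve 5 (λ a b α β T → b :* (α :* T) :- a :* (β :* T) := (b :* α :- a :* β) :* T) refl a b α β T ⟩
    (b * α - a * β) * T
      ≈⟨ *-assoc _ _ _ ⟨
    powerTerm d ((b * α - a * β) * (c * ι (suc d))) (α , β) j ∎
    where
    T = powerTerm d (c * ι (suc d)) (α , β) j

  ∂-+F : ∀ {d} ℓ₀ (f g : Form (suc d)) → ∂[ ℓ₀ ] (f +F g) ≈F (∂[ ℓ₀ ] f +F ∂[ ℓ₀ ] g)
  ∂-+F {d} (a , b) f g j = solve 8
    (λ a b I J f₁ g₁ f₂ g₂ → b :* (I :* (f₁ :+ g₁)) :- a :* (J :* (f₂ :+ g₂))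
                          := (b :* (I :* f₁) :- a :* (J :* f₂)) :+ (b :* (I :* g₁) :- a :* (J :* g₂)))
    refl a b (ι (suc (toℕ j))) (ι (suc d ∸ toℕ j)) (f (Fin.suc j)) (g (Fin.suc j)) (f (inject₁ j)) (g (inject₁ j))

  ∂-cong : ∀ {d} ℓ₀ {f g : Form (suc d)} → f ≈F g → ∂[ ℓ₀ ] f ≈F ∂[ ℓ₀ ] g
  ∂-cong (a , b) f≈g j = +-cong (*-congˡ (*-congˡ (f≈g _))) (-‿cong (*-congˡ (*-congˡ (f≈g _))))

  ∂-0F : ∀ {d} ℓ₀ → ∂[_] {d} ℓ₀ 0F ≈F 0F
  ∂-0F {d} (a , b) j = solve 4 (λ a b I J → b :* (I :* con (+ 0)) :- a :* (J :* con (+ 0)) := con (+ 0))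
    refl a b (ι (suc (toℕ j))) (ι (suc d ∸ toℕ j))

  ∂-sumTerms : ∀ d n ℓ₀ (c : Fin n → Carrier) L →
    ∂[ ℓ₀ ] (sumTerms (suc d) n c L) ≈F sumTerms d n (λ i → det ℓ₀ (L i) * (c i * ι (suc d))) L
  ∂-sumTerms d zero    ℓ₀ c L = ∂-0F ℓ₀
  ∂-sumTerms d (suc n) ℓ₀ c L j =
    trans (∂-+F ℓ₀ (powerTerm (suc d) (head c) (head L)) (sumTerms (suc d) n (tail c) (tail L)) j)
          (+-cong (∂-powerTerm d (head c) ℓ₀ (head L) j) (∂-sumTerms d n ℓ₀ (tail c) (tail L) j))

  ∂-kills-head : ∀ d n (c : Fin (suc n) → Carrier) L →
    ∂[ head L ] (sumTerms (suc d) (suc n) c L) ≈F sumTerms d n (λ i → det (head L) (L (Fin.suc i)) * (c (Fin.suc i) * ι (suc d))) (tail L)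
  ∂-kills-head d n c L j = begin
    ∂[ head L ] (sumTerms (suc d) (suc n) c L) j  ≈⟨ ∂-sumTerms d (suc n) (head L) c L j ⟩
    H + S                                         ≈⟨ +-congʳ (powerTerm-zero d (head L) det≈0 j) ⟩
    0# + S                                        ≈⟨ +-identityˡ S ⟩
    S                                             ∎
    where
    H = powerTerm d (det (head L) (head L) * (head c * ι (suc d))) (head L) j
    S = sumTerms d n (λ i → det (head L) (L (Fin.suc i)) * (c (Fin.suc i) * ι (suc d))) (tail L) j
    det≈0 : det (head L) (head L) * (head c * ι (suc d)) ≈ 0#
    det≈0 = solve 4 (λ a b c I → (b :* a :- a :* b) :* (c :* I) := con (+ 0)) refl
              (proj₁ (head L)) (proj₂ (head L)) (head c) (ι (suc d))

  powers-independent : ∀ {d n} → n ℕ.≤ suc d → (L : Fin n → LinForm) → Honest n L →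
    (c : Fin n → Carrier) → sumTerms d n c L ≈F 0F → ∀ i → ¬ (c i ≉ 0#)
  powers-independent {d} {suc zero} _ L (nz , _) c Σ≈0 Fin.zero c₀≉0 =
    powerTerm≉0F d c₀≉0 (nz Fin.zero) (λ k → trans (sym (+-identityʳ _)) (Σ≈0 k))
  powers-independent {zero} {suc (suc n)} (s≤s ())
  powers-independent {suc d} {suc (suc n)} (s≤s n≤d) L honest@(nz , pw) c Σ≈0 = vanish
    where
    c′ : Fin (suc n) → Carrier
    c′ i = det (head L) (L (Fin.suc i)) * (c (Fin.suc i) * ι (suc d))
    Σ′≈0 : sumTerms d (suc n) c′ (tail L) ≈F 0F
    Σ′≈0 k = trans (sym (∂-kills-head d (suc n) c L k)) (trans (∂-cong (head L) Σ≈0 k) (∂-0F (head L) k))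
    tail-vanishes : ∀ i → ¬ (c (Fin.suc i) ≉ 0#)
    tail-vanishes i cᵢ≉0 = powers-independent n≤d (tail L) (Honest-tail honest) c′ Σ′≈0 i
      (*-≉0 (¬Proportional⇒det≉0 (nz Fin.zero) (pw (Fin.suc i) Fin.zero λ ())) (*-≉0 cᵢ≉0 (ι-suc≉0 d)))
    vanish : ∀ i → ¬ (c i ≉ 0#)
    vanish (Fin.suc i)    = tail-vanishes i
    vanish Fin.zero c₀≉0 = ¬¬-pull-Fin (suc n) tail-vanishes λ tail≈0 →
      powerTerm≉0F (suc d) c₀≉0 (nz Fin.zero) λ k → begin
        powerTerm (suc d) (head c) (head L) k        ≈⟨ +-identityʳ _ ⟨
        powerTerm (suc d) (head c) (head L) k + 0#   ≈⟨ +-congˡ (sumTerms-zero (suc d) (suc n) (tail c) (tail L) tail≈0 k) ⟨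
        sumTerms (suc d) (suc (suc n)) c L k         ≈⟨ Σ≈0 k ⟩
        0#                                           ∎

  powerTerm-≈F⇒¬¬Proportional : ∀ d .{{_ : NonZero d}} {x y ℓ₁ ℓ₂} → x ≉ 0# → NonZeroForm ℓ₁ → NonZeroForm ℓ₂ →
    powerTerm d x ℓ₁ ≈F powerTerm d y ℓ₂ → ¬ ¬ Proportional ℓ₁ ℓ₂
  powerTerm-≈F⇒¬¬Proportional d {x} {y} {ℓ₁} {ℓ₂} x≉0 nz₁ nz₂ eq ¬p =
    powers-independent (s≤s (ℕ.>-nonZero⁻¹ d)) (ℓ₁ ∷ ℓ₂ ∷ []) pair (x ∷ - y ∷ []) difference≈0 Fin.zero x≉0
    where
    pair : Honest 2 (ℓ₁ ∷ ℓ₂ ∷ [])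
    pair = Honest-∷ nz₁ (λ { Fin.zero → ¬p ; (Fin.suc ()) }) (Honest-∷ nz₂ (λ ()) ((λ ()) , λ ()))
    difference≈0 : sumTerms d 2 (x ∷ - y ∷ []) (ℓ₁ ∷ ℓ₂ ∷ []) ≈F 0F
    difference≈0 k = begin
      powerTerm d x ℓ₁ k + (powerTerm d (- y) ℓ₂ k + 0#)   ≈⟨ +-congʳ (eq k) ⟩
      y * Z + ((- y) * Z + 0#)                             ≈⟨ solve 2 (λ y Z → y :* Z :+ ((:- y) :* Z :+ con (+ 0)) := con (+ 0)) refl y Z ⟩
      0#                                                   ∎
      where
      Z = (d C toℕ k) • ((proj₁ ℓ₂ ^ toℕ k) * (proj₂ ℓ₂ ^ (d ∸ toℕ k)))

  Honest⇒powerTerm-injective : ∀ d .{{_ : NonZero d}} {n} {L : Fin n → LinForm} → Honest n L →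
    ∀ {x y i j} → x ≉ 0# → powerTerm d x (L i) ≈F powerTerm d y (L j) → i ≡ j
  Honest⇒powerTerm-injective d (nz , pw) {i = i} {j} x≉0 eq = decidable-stable (i Fin.≟ j) λ i≢j →
    powerTerm-≈F⇒¬¬Proportional d x≉0 (nz i) (nz j) eq (pw i j i≢j)

  sumTerms-updateAt : ∀ d {t} (mu : Fin t → Carrier) m j x →
    sumTerms d t (updateAt mu j (_+ x)) m ≈F (sumTerms d t mu m +F powerTerm d x (m j))
  sumTerms-updateAt d mu m Fin.zero x q = begin
    powerTerm d (head mu + x) (head m) q + S    ≈⟨ +-congʳ (powerTerm-+ d (head mu) x (head m) q) ⟩
    (A + X) + S                                 ≈⟨ solve 3 (λ A X S → (A :+ X) :+ S := (A :+ S) :+ X) refl A X S ⟩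
    (A + S) + X                                 ∎
    where
    A = powerTerm d (head mu) (head m) q
    X = powerTerm d x (head m) q
    S = sumTerms d _ (tail mu) (tail m) q
  sumTerms-updateAt d mu m (Fin.suc j) x q =
    trans (+-congˡ (sumTerms-updateAt d (tail mu) (tail m) j x q)) (sym (+-assoc _ _ _))

  Covers : ∀ d {s t} → (Fin s → Carrier) → (Fin s → LinForm) → (Fin t → Carrier) → (Fin t → LinForm) → Set ℓ
  Covers d lam l mu m = ∀ i → lam i ≉ 0# → ¬ ¬ (∃ λ j → powerTerm d (lam i) (l i) ≈F powerTerm d (mu j) (m j))

  record Matches d {s t} (lam : Fin s → Carrier) (l : Fin s → LinForm)
                 (mu : Fin t → Carrier) (m : Fin t → LinForm) : Set ℓ where
    field
      cover  : Covers d lam l mu m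
      cover⁻ : Covers d mu m lam l

  Matches-stable : ∀ {d s t} {lam : Fin s → Carrier} {l} {mu : Fin t → Carrier} {m} →
    ¬ ¬ Matches d lam l mu m → Matches d lam l mu m
  Matches-stable ¬¬M = record
    { cover  = λ i lamᵢ≉0 → ¬¬M >>= λ M → Matches.cover M i lamᵢ≉0
    ; cover⁻ = λ j muⱼ≉0 → ¬¬M >>= λ M → Matches.cover⁻ M j muⱼ≉0
    }

  -- The first summand is proportional to a summand of the other side: merge it into that one.
  absorb : ∀ d .{{_ : NonZero d}} {s t} {lam : Fin (suc s) → Carrier} {l} {mu : Fin t → Carrier} {m} →
    Honest (suc s) l → Honest t m → (j : Fin t) (pr : Proportional (head l) (m j)) →
    Matches d (tail lam) (tail l) (updateAt mu j (_- head lam * proj₁ pr ^ d)) m → Matches d lam l mu m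
  absorb d {lam = lam} {l} {mu} {m} (nzl , pwl) (nzm , _) j pr@(k , α≈kα′ , β≈kβ′) M =
    record { cover = cover ; cover⁻ = cover⁻ }
    where
    open Matches M renaming (cover to cover′; cover⁻ to cover⁻′)
    e = head lam * k ^ d
    mu′ = updateAt mu j (_- e)
    mu′ⱼ≈ : mu′ j ≈ mu j - e
    mu′ⱼ≈ = reflexive (updateAt-updates j mu)
    unchanged : ∀ {j′} → j′ ≢ j → mu′ j′ ≈ mu j′
    unchanged j′≢j = reflexive (updateAt-minimal _ j mu j′≢j)
    head-matches : ¬ ¬ (powerTerm d (head lam) (head l) ≈F powerTerm d (mu j) (m j))
    head-matches = ¬¬-excluded-middle >>= λ where
      (yes mu′ⱼ≈0) → pure λ q →
        trans (powerTerm-scale d (head lam) α≈kα′ β≈kβ′ q) (*-congʳ (sym (x-y≈0⇒x≈y (trans (sym mu′ⱼ≈) mu′ⱼ≈0))))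
      (no mu′ⱼ≉0) → cover⁻′ j mu′ⱼ≉0 >>= λ (i , eq) →
        ⊥-elim (powerTerm-≈F⇒¬¬Proportional d mu′ⱼ≉0 (nzm j) (nzl (Fin.suc i)) eq λ p →
                  pwl Fin.zero (Fin.suc i) (λ ()) (Proportional-trans pr p))
    cover : Covers d lam l mu m
    cover Fin.zero    _       = head-matches >>= λ eq → pure (j , eq)
    cover (Fin.suc i) lamᵢ≉0 = cover′ i lamᵢ≉0 >>= λ (j′ , eq) → retarget (j′ Fin.≟ j) eq
      where
      retarget : ∀ {j′} → Dec (j′ ≡ j) → powerTerm d (lam (Fin.suc i)) (l (Fin.suc i)) ≈F powerTerm d (mu′ j′) (m j′) →
                 ¬ ¬ (∃ λ j″ → powerTerm d (lam (Fin.suc i)) (l (Fin.suc i)) ≈F powerTerm d (mu j″) (m j″))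
      retarget (yes ≡.refl) eq = ⊥-elim (powerTerm-≈F⇒¬¬Proportional d lamᵢ≉0 (nzl (Fin.suc i)) (nzm j) eq λ p →
        pwl Fin.zero (Fin.suc i) (λ ()) (Proportional-trans pr (Proportional-sym (nzl (Fin.suc i)) p)))
      retarget {j′} (no j′≢j) eq = pure (j′ , λ q → trans (eq q) (*-congʳ (unchanged j′≢j)))
    cover⁻ : Covers d mu m lam l
    cover⁻ j′ muⱼ≉0 with j′ Fin.≟ j
    ... | yes ≡.refl = head-matches >>= λ eq → pure (Fin.zero , λ q → sym (eq q))
    ... | no j′≢j    = cover⁻′ j′ (muⱼ≉0 ∘ trans (sym (unchanged j′≢j))) >>= λ (i , eq) →
      pure (Fin.suc i , λ q → trans (*-congʳ (sym (unchanged j′≢j))) (eq q))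

  -- The first summand is proportional to no summand of the other side: move it across.
  transfer : ∀ d .{{_ : NonZero d}} {s t} {lam : Fin (suc s) → Carrier} {l} {mu : Fin t → Carrier} {m} →
    Honest (suc s) l → Matches d (tail lam) (tail l) (- head lam ∷ mu) (head l ∷ m) → Matches d lam l mu m
  transfer d {lam = lam} {l} {mu} {m} (nzl , pwl) M = record { cover = cover ; cover⁻ = cover⁻ }
    where
    open Matches M renaming (cover to cover′; cover⁻ to cover⁻′)
    head-vanishes : ¬ (head lam ≉ 0#)
    head-vanishes lam₀≉0 = cover⁻′ Fin.zero (-‿≉0 lam₀≉0) λ (i , eq) →
      powerTerm-≈F⇒¬¬Proportional d (-‿≉0 lam₀≉0) (nzl Fin.zero) (nzl (Fin.suc i)) eq (pwl Fin.zero (Fin.suc i) λ ())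
    cover : Covers d lam l mu m
    cover Fin.zero    lam₀≉0 = contradiction lam₀≉0 head-vanishes
    cover (Fin.suc i) lamᵢ≉0 = cover′ i lamᵢ≉0 >>= λ where
      (Fin.zero , eq)  → ⊥-elim (powerTerm-≈F⇒¬¬Proportional d lamᵢ≉0 (nzl (Fin.suc i)) (nzl Fin.zero) eq
                                   (pwl (Fin.suc i) Fin.zero λ ()))
      (Fin.suc j , eq) → pure (j , eq)
    cover⁻ : Covers d mu m lam l
    cover⁻ j muⱼ≉0 = cover⁻′ (Fin.suc j) muⱼ≉0 >>= λ (i , eq) → pure (Fin.suc i , eq)

  WithinBound : ∀ d {s t} → (Fin s → LinForm) → (Fin t → LinForm) → Set (c ⊔ ℓ)
  WithinBound d {s} {t} l m = s ℕ.+ t ℕ.≤ suc d ⊎ (s ℕ.+ t ℕ.≤ suc (suc d) × ∃₂ λ i j → Proportional (l i) (m j))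

  matching : ∀ d .{{_ : NonZero d}} {s t} (lam : Fin s → Carrier) l (mu : Fin t → Carrier) m →
    Honest s l → Honest t m → sumTerms d s lam l ≈F sumTerms d t mu m → WithinBound d l m → Matches d lam l mu m
  matching d {zero} {t} lam l mu m _ hm same bound = record
    { cover  = λ ()
    ; cover⁻ = λ j muⱼ≉0 _ → powers-independent (t≤ bound) m hm mu (λ k → sym (same k)) j muⱼ≉0
    }
    where
    t≤ : WithinBound d l m → t ℕ.≤ suc d
    t≤ (inj₁ t≤d+1)          = t≤d+1
    t≤ (inj₂ (_ , () , _))
  matching d {suc s} {t} lam l mu m hl hm same bound = Matches-stable (¬¬-map step ¬¬-excluded-middle)
    where
    step : Dec (∃ λ j → Proportional (head l) (m j)) → Matches d lam l mu m
    step (yes (j , pr@(k , α≈kα′ , β≈kβ′))) = absorb d hl hm j pr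
      (matching d (tail lam) (tail l) (updateAt mu j (_- e)) m (Honest-tail hl) hm absorbed-same (inj₁ (shrink bound)))
      where
      e = head lam * k ^ d
      absorbed-same : sumTerms d s (tail lam) (tail l) ≈F sumTerms d t (updateAt mu j (_- e)) m
      absorbed-same q = begin
        S                                                 ≈⟨ solve 2 (λ H S → S := (H :+ S) :- H) refl H S ⟩
        (H + S) - H                                       ≈⟨ +-cong (same q) (-‿cong (powerTerm-scale d (head lam) α≈kα′ β≈kβ′ q)) ⟩
        sumTerms d t mu m q - powerTerm d e (m j) q       ≈⟨ +-congˡ (-‿distribˡ-* _ _) ⟩
        sumTerms d t mu m q + powerTerm d (- e) (m j) q   ≈⟨ sumTerms-updateAt d mu m j (- e) q ⟨
        sumTerms d t (updateAt mu j (_- e)) m q           ∎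
        where
        H = powerTerm d (head lam) (head l) q
        S = sumTerms d s (tail lam) (tail l) q
      shrink : WithinBound d l m → s ℕ.+ t ℕ.≤ suc d
      shrink (inj₁ 1+s+t≤d+1)       = ℕₚ.≤-trans (ℕₚ.n≤1+n _) 1+s+t≤d+1
      shrink (inj₂ (1+s+t≤d+2 , _)) = ℕ.s≤s⁻¹ 1+s+t≤d+2
    step (no new) = transfer d hl
      (matching d (tail lam) (tail l) (- head lam ∷ mu) (head l ∷ m) (Honest-tail hl)
                (Honest-∷ (proj₁ hl Fin.zero) (λ j p → new (j , p)) hm) transferred-same (grow bound))
      where
      transferred-same : sumTerms d s (tail lam) (tail l) ≈F sumTerms d (suc t) (- head lam ∷ mu) (head l ∷ m)
      transferred-same q = begin
        S                                                           ≈⟨ solve 2 (λ H S → S := :- H :+ (H :+ S)) refl H S ⟩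
        - H + (H + S)                                               ≈⟨ +-cong (-‿distribˡ-* _ _) (same q) ⟩
        powerTerm d (- head lam) (head l) q + sumTerms d t mu m q   ∎
        where
        H = powerTerm d (head lam) (head l) q
        S = sumTerms d s (tail lam) (tail l) q
      s+[1+t]≡1+s+t : s ℕ.+ suc t ≡ suc s ℕ.+ t
      s+[1+t]≡1+s+t = ℕₚ.+-suc s t
      grow : WithinBound d l m → WithinBound d (tail l) (head l ∷ m)
      grow (inj₁ s+t≤)                     = inj₁ (≡.subst (ℕ._≤ suc d) (≡.sym s+[1+t]≡1+s+t) s+t≤)
      grow (inj₂ (_ , Fin.zero , j , pr))    = contradiction (j , pr) new
      grow (inj₂ (s+t≤ , Fin.suc i , j , pr)) = inj₂ (≡.subst (ℕ._≤ suc (suc d)) (≡.sym s+[1+t]≡1+s+t) s+t≤ , i , Fin.suc j , pr)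

  Assignment : ∀ d {s t} → (Fin s → Carrier) → (Fin s → LinForm) → (Fin t → Carrier) → (Fin t → LinForm) → Set ℓ
  Assignment d lam l mu m = ∀ i → ∃ λ j → powerTerm d (lam i) (l i) ≈F powerTerm d (mu j) (m j)

  matches⇒¬¬Rearrangement : ∀ d .{{_ : NonZero d}} {s t} {lam : Fin s → Carrier} {l} {mu : Fin t → Carrier} {m} →
    Honest s l → Honest t m → (∀ i → lam i ≉ 0#) → (∀ j → mu j ≉ 0#) → Matches d lam l mu m →
    ¬ ¬ Rearrangement d s t lam l mu m
  matches⇒¬¬Rearrangement d {s} {t} {lam} {l} {mu} {m} hl hm lam≉0 mu≉0 M = do
    to   ← ¬¬-pull-Fin s λ i → cover i (lam≉0 i)
    from ← ¬¬-pull-Fin t λ j → cover⁻ j (mu≉0 j)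
    pure (rearrange to from)
    where
    open Matches M
    rearrange : Assignment d lam l mu m → Assignment d mu m lam l → Rearrangement d s t lam l mu m
    rearrange to from = mk↔ₛ′ (proj₁ ∘ to) (proj₁ ∘ from) to∘from from∘to , proj₂ ∘ to
      where
      to∘from : ∀ j → proj₁ (to (proj₁ (from j))) ≡ j
      to∘from j = Honest⇒powerTerm-injective d hm (mu≉0 _)
        λ q → trans (sym (proj₂ (to (proj₁ (from j))) q)) (sym (proj₂ (from j) q))
      from∘to : ∀ i → proj₁ (from (proj₁ (to i))) ≡ i
      from∘to i = Honest⇒powerTerm-injective d hl (lam≉0 _)
        λ q → trans (sym (proj₂ (from (proj₁ (to i))) q)) (sym (proj₂ (to i) q))

  few-terms⇒¬¬Rearrangement : ∀ d {s t} (lam : Fin s → Carrier) l (mu : Fin t → Carrier) m →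
    sumTerms d s lam l ≈F sumTerms d t mu m → Honest s l → Honest t m →
    (∀ i → lam i ≉ 0#) → (∀ j → mu j ≉ 0#) → s ℕ.+ t ℕ.≤ suc d → ¬ ¬ Rearrangement d s t lam l mu m
  few-terms⇒¬¬Rearrangement (suc d) lam l mu m same hl hm lam≉0 mu≉0 s+t≤ =
    matches⇒¬¬Rearrangement (suc d) hl hm lam≉0 mu≉0 (matching (suc d) lam l mu m hl hm same (inj₁ s+t≤))
  few-terms⇒¬¬Rearrangement zero {zero}  {zero}  _ _ _ _ _ _ _ _ _ _ =
    pure (mk↔ₛ′ (λ ()) (λ ()) (λ ()) (λ ()) , λ ())
  few-terms⇒¬¬Rearrangement zero {suc zero} {zero} lam l _ _ same hl _ lam≉0 _ s+t≤ _ =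
    powers-independent s+t≤ l hl lam same Fin.zero (lam≉0 Fin.zero)
  few-terms⇒¬¬Rearrangement zero {zero} {suc zero} _ _ mu m same _ hm _ mu≉0 s+t≤ _ =
    powers-independent s+t≤ m hm mu (λ k → sym (same k)) Fin.zero (mu≉0 Fin.zero)
  few-terms⇒¬¬Rearrangement zero {suc (suc _)}        _ _ _ _ _ _ _ _ _ (s≤s ())
  few-terms⇒¬¬Rearrangement zero {suc zero} {suc _}    _ _ _ _ _ _ _ _ _ (s≤s ())
  few-terms⇒¬¬Rearrangement zero {zero} {suc (suc _)} _ _ _ _ _ _ _ _ _ (s≤s ())

  cross-pair⇒¬¬Rearrangement : ∀ d {s t} (lam : Fin s → Carrier) l (mu : Fin t → Carrier) m →
    sumTerms d s lam l ≈F sumTerms d t mu m → Honest s l → Honest t m →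
    (∀ i → lam i ≉ 0#) → (∀ j → mu j ≉ 0#) → s ℕ.+ t ℕ.≤ suc (suc d) →
    (∃₂ λ i j → Proportional (l i) (m j)) → ¬ ¬ Rearrangement d s t lam l mu m
  cross-pair⇒¬¬Rearrangement (suc d) lam l mu m same hl hm lam≉0 mu≉0 s+t≤ pair =
    matches⇒¬¬Rearrangement (suc d) hl hm lam≉0 mu≉0 (matching (suc d) lam l mu m hl hm same (inj₂ (s+t≤ , pair)))
  cross-pair⇒¬¬Rearrangement zero {suc zero} {suc zero} _ _ _ _ same _ _ _ _ _ _ =
    pure (mk↔ₛ′ id id (λ _ → ≡.refl) (λ _ → ≡.refl) , λ where
      Fin.zero k → trans (sym (+-identityʳ _)) (trans (same k) (+-identityʳ _)))
  cross-pair⇒¬¬Rearrangement zero {suc zero} {suc (suc _)} _ _ _ _ _ _ _ _ _ (s≤s (s≤s ())) _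
  cross-pair⇒¬¬Rearrangement zero {suc (suc s)} {suc _} _ _ _ _ _ _ _ _ _ (s≤s (s≤s s+[1+t]≤0)) _ =
    contradiction (ℕₚ.n≤0⇒n≡0 s+[1+t]≤0) (ℕₚ.m+1+n≢0 s)
  cross-pair⇒¬¬Rearrangement zero {zero}          _ _ _ _ _ _ _ _ _ _ (() , _)
  cross-pair⇒¬¬Rearrangement zero {suc _} {zero} _ _ _ _ _ _ _ _ _ _ (_ , () , _)

open import Data.Nat using (_+_; _≤_)

corollary4p3 : ∀ {c ℓ : Level} (K : ACField₀ c ℓ) →
    let open Forms K
    in
    (d s t : ℕ)
    (lam : Fin s → Carrier) (l : Fin s → LinForm)
    (mu : Fin t → Carrier) (m : Fin t → LinForm)
    (f : Form d) →
    f ≈F sumTerms d s lam l →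
    f ≈F sumTerms d t mu m →
    Honest s l → Honest t m →
    (∀ i → ¬ (lam i ≈ 0#)) → (∀ j → ¬ (mu j ≈ 0#)) →
    ¬ Rearrangement d s t lam l mu m →
    (d + 2 ≤ s + t) × (s + t ≡ d + 2 → PairwiseNonProp (s + t) (combine l m))
corollary4p3 K d s t lam l mu m f f≈Σl f≈Σm hl hm lam≉0 mu≉0 ¬rearrangement = lower-bound , extremal
  where
  open ACField₀ K using (sym; trans)
  open Forms K using (_≈F_; sumTerms; PairwiseNonProp; combine)
  open Representations K
  same : sumTerms d s lam l ≈F sumTerms d t mu m
  same k = trans (sym (f≈Σl k)) (f≈Σm k)
  d+2≡2+d : d + 2 ≡ suc (suc d)
  d+2≡2+d = ℕₚ.+-comm d 2
  lower-bound : d + 2 ≤ s + t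
  lower-bound = ℕₚ.≮⇒≥ λ s+t<d+2 →
    few-terms⇒¬¬Rearrangement d lam l mu m same hl hm lam≉0 mu≉0
      (ℕ.s≤s⁻¹ (≡.subst (s + t ℕ.<_) d+2≡2+d s+t<d+2)) ¬rearrangement
  extremal : s + t ≡ d + 2 → PairwiseNonProp (s + t) (combine l m)
  extremal s+t≡d+2 = PairwiseNonProp-++ (proj₂ hl) (proj₂ hm) (proj₁ hm) λ i j p →
    cross-pair⇒¬¬Rearrangement d lam l mu m same hl hm lam≉0 mu≉0
      (ℕₚ.≤-reflexive (≡.trans s+t≡d+2 d+2≡2+d)) (i , j , p) ¬rearrangement
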